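{- For each pair $(n,k)$ with (1) $n=4$ and $k\in\{4,6,8,10\}$, or (2) $n=5$ and $k\in\{4,16,18,20,22,24,26\}$, or (3) $n=6$ and $k=54$, or (4) $n=7$ and $k=114$, there exists a $k$-regular closed XOR-magic graph of power $n$.
   Context: All graphs are simple; a graph is $k$-regular if every vertex has exactly $k$ neighbours. For a vertex $x$, $N[x]$ is the set consisting of $x$ and its neighbours. A simple connected graph $G=(V,E)$ with $|V|=2^n$ is a closed XOR-magic graph of power $n$ if there is a bijection $\ell:V\to(\mathbb{Z}_2)^n$ such that $\sum_{y\in N[x]}\ell(y)$ is the zero vector of $(\mathbb{Z}_2)^n$ for every $x\in V$. -}

module Defs where

open import Data.Nat using (ℕ; zero; suc; _+_; _^_)
open import Data.Bool using (Bool; true; false; _xor_; if_then_else_)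
open import Data.Fin using (Fin)
open import Data.Vec using (Vec; replicate; zipWith)
open import Data.List using (List; []; _∷_; filter; length)
open import Data.List.Base using (allFin)
open import Data.Product using (Σ; _×_; ∃)
open import Function.Bundles using (_⤖_; Bijection)
open import Relation.Binary.PropositionalEquality using (_≡_)
open import Relation.Nullary using (¬_)
open import Data.Bool.Properties using (T?)

record SimpleGraph (m : ℕ) : Set where
  field
    Adj   : Fin m → Fin m → Bool
    sym   : ∀ x y → Adj x y ≡ Adj y x
    loopless : ∀ x → Adj x x ≡ false
open SimpleGraph public

data Walk {m : ℕ} (G : SimpleGraph m) : Fin m → Fin m → Set where
  nil  : ∀ {x} → Walk G x x
  cons : ∀ {x y z} → Adj G x y ≡ true → Walk G y z → Walk G x z

Connected : ∀ {m} → SimpleGraph m → Set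
Connected {m} G = ∀ (x y : Fin m) → Walk G x y

neighbours : ∀ {m} → SimpleGraph m → Fin m → List (Fin m)
neighbours {m} G x = filter (λ y → T? (Adj G x y)) (allFin m)

degree : ∀ {m} → SimpleGraph m → Fin m → ℕ
degree G x = length (neighbours G x)

Regular : ∀ {m} → ℕ → SimpleGraph m → Set
Regular {m} k G = ∀ (x : Fin m) → degree G x ≡ k

Z2^ : ℕ → Set
Z2^ n = Vec Bool n

zeroV : ∀ n → Z2^ n
zeroV n = replicate n false

_⊕_ : ∀ {n} → Z2^ n → Z2^ n → Z2^ n
_⊕_ = zipWith _xor_

sumV : ∀ {n} → List (Z2^ n) → Z2^ n
sumV {n} [] = zeroV n
sumV (v ∷ vs) = v ⊕ sumV vs

closedNbhdSum : ∀ {m n} → SimpleGraph m → (Fin m → Z2^ n) → Fin m → Z2^ n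
closedNbhdSum G ℓ x = ℓ x ⊕ sumV (Data.List.map ℓ (neighbours G x))

IsClosedXORMagic : (n : ℕ) → SimpleGraph (2 ^ n) → Set
IsClosedXORMagic n G =
  Connected G ×
  Σ (Fin (2 ^ n) ⤖ Z2^ n) λ ℓ →
    ∀ x → closedNbhdSum G (Bijection.to ℓ) x ≡ zeroV n

-- existence of a k-regular closed XOR-magic graph of power n
-- (vertex set taken as Fin (2^n), i.e. up to isomorphism)
ExistsRegularCXM : ℕ → ℕ → Set
ExistsRegularCXM n k = Σ (SimpleGraph (2 ^ n)) λ G → Regular k G × IsClosedXORMagic n G

{-# OPTIONS --safe #-}
-- The graphs are exhibited explicitly (they were found by computer search).  Labelling
-- vertex i by the binary expansion of i, the closed XOR-magic condition and regularity are
-- finite checks, and so is connectivity once a spanning tree is supplied; all of them are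
-- decided by evaluation.
module Submission where

open import Defs hiding (sym)
open import Data.Bool using (Bool; true; _∧_; not)
open import Data.Bool.Properties using (∧-comm) renaming (_≟_ to _≟ᵇ_)
open import Data.Fin using (Fin; zero; toℕ; #_)
open import Data.Fin.Properties using (_≟_; all?; *↔×; 2↔Bool)
open import Data.Nat using (ℕ; zero; suc; _^_; _/_; _%_; _≡ᵇ_)
open import Data.Nat.Properties using () renaming (_≟_ to _≟ℕ_)
open import Data.Product using (_×_; _,_; uncurry)
open import Data.Product.Function.NonDependent.Propositional using (_×-↔_)
open import Data.Sum using (_⊎_; inj₁; inj₂)
open import Data.Vec using (Vec; []; _∷_; lookup; uncons)
open import Data.Vec.Properties using (≡-dec)
open import Function using (_∘_)
open import Function.Bundles using (_↔_; mk↔ₛ′; Inverse)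
open import Function.Properties.Inverse using (↔-trans; ↔⇒⤖)
open import Relation.Binary.PropositionalEquality using (_≡_; refl; sym; trans; cong; cong₂)
open import Relation.Nullary using (Dec; does; yes; no)
open import Relation.Nullary.Decidable
  using (True; toWitness; dec-true; dec-false; _×-dec_; _⊎-dec_)
open import Relation.Unary using (Decidable)

∷↔ : ∀ {A : Set} {n} → (A × Vec A n) ↔ Vec A (suc n)
∷↔ = mk↔ₛ′ (uncurry _∷_) uncons (λ { (x ∷ xs) → refl }) (λ _ → refl)

-- Most significant bit first: the leading bit of i is its quotient by 2 ^ n.
binary : ∀ n → Fin (2 ^ n) ↔ Z2^ n
binary zero    = mk↔ₛ′ (λ _ → []) (λ _ → zero) (λ { [] → refl }) (λ { zero → refl })
binary (suc n) = ↔-trans *↔× (↔-trans (2↔Bool ×-↔ binary n) ∷↔)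

does-≟-sym : ∀ {m} (x y : Fin m) → does (x ≟ y) ≡ does (y ≟ x)
does-≟-sym x y with x ≟ y
... | yes x≡y = sym (dec-true (y ≟ x) (sym x≡y))
... | no x≢y  = sym (dec-false (y ≟ x) (x≢y ∘ sym))

simpleCore : ∀ {m} → (Fin m → Fin m → Bool) → SimpleGraph m
simpleCore R = record
  { Adj      = λ x y → not (does (x ≟ y)) ∧ (R x y ∧ R y x)
  ; sym      = λ x y → cong₂ _∧_ (cong not (does-≟-sym x y)) (∧-comm (R x y) (R y x))
  ; loopless = λ x → cong (λ b → not b ∧ (R x x ∧ R x x)) (dec-true (x ≟ x) refl)
  }

module _ {m} {G : SimpleGraph m} where

  _++ʷ_ : ∀ {x y z} → Walk G x y → Walk G y z → Walk G x z
  nil      ++ʷ w = w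
  cons e v ++ʷ w = cons e (v ++ʷ w)

  reverseʷ : ∀ {x y} → Walk G x y → Walk G y x
  reverseʷ nil                = nil
  reverseʷ (cons {x} {y} e w) = reverseʷ w ++ʷ cons (trans (SimpleGraph.sym G y x) e) nil

  connected-via : ∀ root → (∀ x → Walk G x root) → Connected G
  connected-via root walk x y = walk x ++ʷ reverseʷ (walk y)

module SpanningTree {m} (G : SimpleGraph m) (root : Fin m) (parent : Fin m → Fin m) where

  Climbs : ℕ → Fin m → Set
  Climbs zero    x = x ≡ root
  Climbs (suc d) x = x ≡ root ⊎ (Adj G x (parent x) ≡ true × Climbs d (parent x))

  climbs? : ∀ d → Decidable (Climbs d)
  climbs? zero    x = x ≟ root
  climbs? (suc d) x = x ≟ root ⊎-dec (Adj G x (parent x) ≟ᵇ true ×-dec climbs? d (parent x))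

  climbs⇒walk : ∀ d {x} → Climbs d x → Walk G x root
  climbs⇒walk zero    refl                = nil
  climbs⇒walk (suc d) (inj₁ refl)         = nil
  climbs⇒walk (suc d) (inj₂ (e , climbs)) = cons e (climbs⇒walk d climbs)

testBit : ℕ → ℕ → Bool
testBit r zero    = r % 2 ≡ᵇ 1
testBit r (suc i) = testBit (r / 2) i

-- Bit y of rows[x] is set iff x ~ y; parent[x] is the parent of x in a spanning tree.
record Certificate (n : ℕ) : Set where
  field
    rows   : Vec ℕ (2 ^ n)
    root   : Fin (2 ^ n)
    parent : Vec (Fin (2 ^ n)) (2 ^ n)

module Certified {n} (c : Certificate n) where
  open Certificate c

  graph : SimpleGraph (2 ^ n)
  graph = simpleCore λ x y → testBit (lookup rows x) (toℕ y)

  label : Fin (2 ^ n) → Z2^ n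
  label = Inverse.to (binary n)

  open SpanningTree graph root (lookup parent)

  Valid : ℕ → Set
  Valid k = Regular k graph
          × (∀ x → Climbs (2 ^ n) x)
          × (∀ x → closedNbhdSum graph label x ≡ zeroV n)

  valid? : ∀ k → Dec (Valid k)
  valid? k = all? (λ x → degree graph x ≟ℕ k)
       ×-dec all? (climbs? (2 ^ n))
       ×-dec all? (λ x → ≡-dec _≟ᵇ_ (closedNbhdSum graph label x) (zeroV n))

  valid⇒exists : ∀ {k} → Valid k → ExistsRegularCXM n k
  valid⇒exists (regular , climbs , magic) =
    graph , regular , connected-via root (λ x → climbs⇒walk _ (climbs x)) , ↔⇒⤖ (binary n) , magic

certify : ∀ {n} (c : Certificate n) k → {True (Certified.valid? c k)} → ExistsRegularCXM n k
certify c k {valid} = Certified.valid⇒exists c (toWitness valid)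

certificate-4-4 : Certificate 4
certificate-4-4 = record
  { rows   =
      40970 ∷ 36869 ∷ 33314 ∷ 10273 ∷ 18624 ∷ 17420 ∷ 18576 ∷ 8528 ∷ 5760 ∷ 24836 ∷ 6432 ∷ 1112 ∷
      34050 ∷ 649 ∷ 624 ∷ 4103 ∷ []
  ; root   = # 0
  ; parent =
      # 0 ∷ # 0 ∷ # 1 ∷ # 0 ∷ # 11 ∷ # 3 ∷ # 11 ∷ # 13 ∷ # 12 ∷ # 13 ∷ # 12 ∷ # 3 ∷ # 1 ∷ # 0 ∷
      # 5 ∷ # 0 ∷ []
  }

certificate-4-6 : Certificate 4
certificate-4-6 = record
  { rows   =
      10456 ∷ 18612 ∷ 46210 ∷ 18241 ∷ 33379 ∷ 43538 ∷ 5273 ∷ 20551 ∷ 63496 ∷ 13368 ∷ 35404 ∷ 9507 ∷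
      17348 ∷ 2853 ∷ 37258 ∷ 17716 ∷ []
  ; root   = # 0
  ; parent =
      # 0 ∷ # 4 ∷ # 7 ∷ # 0 ∷ # 0 ∷ # 4 ∷ # 0 ∷ # 0 ∷ # 3 ∷ # 3 ∷ # 3 ∷ # 0 ∷ # 6 ∷ # 0 ∷ # 3 ∷
      # 4 ∷ []
  }

certificate-4-8 : Certificate 4
certificate-4-8 = record
  { rows   =
      32130 ∷ 4829 ∷ 15002 ∷ 44134 ∷ 58022 ∷ 62744 ∷ 56586 ∷ 52247 ∷ 63585 ∷ 31766 ∷ 35561 ∷ 1997 ∷
      9063 ∷ 4925 ∷ 33777 ∷ 17912 ∷ []
  ; root   = # 0
  ; parent =
      # 0 ∷ # 0 ∷ # 1 ∷ # 1 ∷ # 1 ∷ # 8 ∷ # 1 ∷ # 0 ∷ # 0 ∷ # 1 ∷ # 0 ∷ # 0 ∷ # 0 ∷ # 0 ∷ # 0 ∷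
      # 7 ∷ []
  }

certificate-4-10 : Certificate 4
certificate-4-10 = record
  { rows   =
      43516 ∷ 62268 ∷ 55115 ∷ 36279 ∷ 63019 ∷ 40155 ∷ 60325 ∷ 32361 ∷ 31823 ∷ 48342 ∷ 58300 ∷
      54249 ∷ 27574 ∷ 22483 ∷ 15830 ∷ 3711 ∷ []
  ; root   = # 0
  ; parent =
      # 0 ∷ # 2 ∷ # 0 ∷ # 0 ∷ # 0 ∷ # 0 ∷ # 0 ∷ # 0 ∷ # 0 ∷ # 2 ∷ # 2 ∷ # 0 ∷ # 2 ∷ # 0 ∷ # 2 ∷
      # 0 ∷ []
  }

certificate-5-4 : Certificate 5
certificate-5-4 = record
  { rows   =
      135268368 ∷ 69208096 ∷ 6294528 ∷ 1212928 ∷ 20545 ∷ 6291586 ∷ 16843792 ∷ 17842208 ∷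
      2147624960 ∷ 4751368 ∷ 2147614788 ∷ 263 ∷ 301998096 ∷ 1082134784 ∷ 2147745936 ∷ 553648648 ∷
      1704000 ∷ 66824 ∷ 1241530368 ∷ 2149646848 ∷ 65673 ∷ 524326 ∷ 16777764 ∷ 939532288 ∷ 4227264 ∷
      604246016 ∷ 1375731714 ∷ 1082392577 ∷ 612372480 ∷ 310411264 ∷ 201596928 ∷ 541952 ∷ []
  ; root   = # 0
  ; parent =
      # 0 ∷ # 11 ∷ # 11 ∷ # 20 ∷ # 0 ∷ # 1 ∷ # 4 ∷ # 20 ∷ # 11 ∷ # 3 ∷ # 6 ∷ # 0 ∷ # 4 ∷ # 12 ∷
      # 4 ∷ # 3 ∷ # 20 ∷ # 8 ∷ # 27 ∷ # 16 ∷ # 0 ∷ # 1 ∷ # 2 ∷ # 27 ∷ # 6 ∷ # 12 ∷ # 1 ∷ # 0 ∷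
      # 12 ∷ # 23 ∷ # 27 ∷ # 14 ∷ []
  }

certificate-5-16 : Certificate 5
certificate-5-16 = record
  { rows   =
      533242230 ∷ 2021494937 ∷ 3561908937 ∷ 463675078 ∷ 2654270595 ∷ 2941473665 ∷ 1684792845 ∷
      639416638 ∷ 2222419617 ∷ 2533489004 ∷ 3513178456 ∷ 3780487052 ∷ 396961466 ∷ 1222941653 ∷
      4169762676 ∷ 2687921875 ∷ 2761579370 ∷ 1934984556 ∷ 197832086 ∷ 501567687 ∷ 3166931378 ∷
      3817387354 ∷ 3231591783 ∷ 2055041033 ∷ 3861782057 ∷ 3450213049 ∷ 1662587893 ∷ 4070334523 ∷
      1754945055 ∷ 498321634 ∷ 534932550 ∷ 192007988 ∷ []
  ; root   = # 0
  ; parent =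
      # 0 ∷ # 0 ∷ # 0 ∷ # 1 ∷ # 0 ∷ # 0 ∷ # 0 ∷ # 1 ∷ # 0 ∷ # 2 ∷ # 4 ∷ # 2 ∷ # 1 ∷ # 0 ∷ # 2 ∷
      # 0 ∷ # 1 ∷ # 2 ∷ # 1 ∷ # 0 ∷ # 1 ∷ # 1 ∷ # 0 ∷ # 0 ∷ # 0 ∷ # 0 ∷ # 0 ∷ # 0 ∷ # 0 ∷ # 1 ∷
      # 1 ∷ # 2 ∷ []
  }

certificate-5-18 : Certificate 5
certificate-5-18 = record
  { rows   =
      2396738966 ∷ 2060880357 ∷ 4203589939 ∷ 2880338656 ∷ 3882237125 ∷ 2847456910 ∷ 3711527578 ∷
      3312036219 ∷ 4045379207 ∷ 4197374312 ∷ 393736497 ∷ 2547192570 ∷ 2522058557 ∷ 1643873532 ∷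
      2110752329 ∷ 229472166 ∷ 3267820997 ∷ 3594616603 ∷ 1541523230 ∷ 1831920621 ∷ 1055407459 ∷
      2900141816 ∷ 431455379 ∷ 2775967791 ∷ 650964472 ∷ 3642170911 ∷ 1908071633 ∷ 1920778863 ∷
      2924896070 ∷ 1572365118 ∷ 2920244182 ∷ 1386421245 ∷ []
  ; root   = # 0
  ; parent =
      # 0 ∷ # 0 ∷ # 0 ∷ # 7 ∷ # 0 ∷ # 1 ∷ # 1 ∷ # 0 ∷ # 0 ∷ # 8 ∷ # 0 ∷ # 1 ∷ # 0 ∷ # 2 ∷ # 0 ∷
      # 1 ∷ # 0 ∷ # 0 ∷ # 1 ∷ # 0 ∷ # 0 ∷ # 4 ∷ # 0 ∷ # 0 ∷ # 4 ∷ # 0 ∷ # 0 ∷ # 0 ∷ # 1 ∷ # 1 ∷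
      # 1 ∷ # 0 ∷ []
  }

certificate-5-20 : Certificate 5
certificate-5-20 = record
  { rows   =
      2369443830 ∷ 1530379445 ∷ 3489438915 ∷ 4234764272 ∷ 936619691 ∷ 3046861723 ∷ 4209881741 ∷
      2883330943 ∷ 2931130025 ∷ 1855433209 ∷ 2784606495 ∷ 418117438 ∷ 3990293839 ∷ 1954385906 ∷
      2013235497 ∷ 1518038615 ∷ 1395064698 ∷ 2648562227 ∷ 4016272326 ∷ 3856854253 ∷ 3548575671 ∷
      3675123023 ∷ 4128177372 ∷ 4078591988 ∷ 1556042935 ∷ 3975529430 ∷ 2874046269 ∷ 3072760783 ∷
      3925076090 ∷ 1590458360 ∷ 872280654 ∷ 519968237 ∷ []
  ; root   = # 0
  ; parent =
      # 0 ∷ # 0 ∷ # 0 ∷ # 4 ∷ # 0 ∷ # 0 ∷ # 0 ∷ # 0 ∷ # 0 ∷ # 0 ∷ # 0 ∷ # 1 ∷ # 0 ∷ # 1 ∷ # 0 ∷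
      # 0 ∷ # 1 ∷ # 0 ∷ # 1 ∷ # 0 ∷ # 0 ∷ # 0 ∷ # 2 ∷ # 2 ∷ # 0 ∷ # 1 ∷ # 0 ∷ # 0 ∷ # 1 ∷ # 4 ∷
      # 1 ∷ # 0 ∷ []
  }

certificate-5-22 : Certificate 5
certificate-5-22 = record
  { rows   =
      3676036846 ∷ 3734696925 ∷ 3488333155 ∷ 922685427 ∷ 2128472938 ∷ 2478693853 ∷ 1990520767 ∷
      4025082731 ∷ 2625076478 ∷ 3120024795 ∷ 2002744173 ∷ 3925775229 ∷ 4276546855 ∷ 1065080278 ∷
      4100438003 ∷ 4187781879 ∷ 4273104829 ∷ 3824779023 ∷ 3755532152 ∷ 2943790271 ∷ 1867493179 ∷
      2110487532 ∷ 3820912540 ∷ 3949435646 ∷ 4210994853 ∷ 1306473727 ∷ 4198331870 ∷ 2545793943 ∷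
      3978688379 ∷ 2516319960 ∷ 402119895 ∷ 1037032359 ∷ []
  ; root   = # 0
  ; parent =
      # 0 ∷ # 0 ∷ # 0 ∷ # 0 ∷ # 1 ∷ # 0 ∷ # 0 ∷ # 0 ∷ # 1 ∷ # 0 ∷ # 0 ∷ # 0 ∷ # 0 ∷ # 1 ∷ # 0 ∷
      # 0 ∷ # 0 ∷ # 0 ∷ # 3 ∷ # 0 ∷ # 0 ∷ # 2 ∷ # 2 ∷ # 1 ∷ # 0 ∷ # 0 ∷ # 1 ∷ # 0 ∷ # 0 ∷ # 3 ∷
      # 0 ∷ # 0 ∷ []
  }

certificate-5-24 : Certificate 5
certificate-5-24 = record
  { rows   =
      3742629630 ∷ 3209682809 ∷ 4226790897 ∷ 4092321523 ∷ 1020788655 ∷ 3472334303 ∷ 1433927599 ∷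
      2104474493 ∷ 4156223222 ∷ 3351246299 ∷ 4294714239 ∷ 4288016891 ∷ 3747310335 ∷ 4089372629 ∷
      4293737307 ∷ 2935696383 ∷ 2096945919 ∷ 3925652479 ∷ 3216731894 ∷ 4151834510 ∷ 4023369585 ∷
      4287621100 ∷ 4288402686 ∷ 2138566460 ∷ 1325301711 ∷ 3120365359 ∷ 1912463347 ∷ 4093107383 ∷
      2934799839 ∷ 2667572638 ∷ 2382069741 ∷ 2055143215 ∷ []
  ; root   = # 0
  ; parent =
      # 0 ∷ # 0 ∷ # 0 ∷ # 0 ∷ # 0 ∷ # 0 ∷ # 0 ∷ # 0 ∷ # 1 ∷ # 0 ∷ # 0 ∷ # 0 ∷ # 0 ∷ # 0 ∷ # 0 ∷
      # 0 ∷ # 0 ∷ # 0 ∷ # 1 ∷ # 1 ∷ # 0 ∷ # 2 ∷ # 1 ∷ # 2 ∷ # 0 ∷ # 0 ∷ # 0 ∷ # 0 ∷ # 0 ∷ # 1 ∷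
      # 0 ∷ # 0 ∷ []
  }

certificate-5-26 : Certificate 5
certificate-5-26 = record
  { rows   =
      4293653998 ∷ 4294953717 ∷ 3488350075 ∷ 3757571701 ∷ 4294942606 ∷ 4206821327 ∷ 2147344175 ∷
      4294950195 ∷ 4160683253 ∷ 4269800574 ∷ 4127157245 ∷ 4289394686 ∷ 3086986237 ∷ 4288667565 ∷
      3221073775 ∷ 2667412479 ∷ 4292277983 ∷ 3690807231 ∷ 4024170490 ∷ 3956735991 ∷ 3211786234 ∷
      4023574527 ∷ 1874843615 ∷ 1970273791 ∷ 4177493471 ∷ 3028286463 ∷ 2062942175 ∷ 4118801151 ∷
      4019453947 ∷ 1610448883 ∷ 3186569215 ∷ 1530920895 ∷ []
  ; root   = # 0
  ; parent =
      # 0 ∷ # 0 ∷ # 0 ∷ # 0 ∷ # 1 ∷ # 0 ∷ # 0 ∷ # 0 ∷ # 0 ∷ # 1 ∷ # 0 ∷ # 1 ∷ # 0 ∷ # 0 ∷ # 0 ∷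
      # 0 ∷ # 0 ∷ # 0 ∷ # 1 ∷ # 0 ∷ # 1 ∷ # 0 ∷ # 0 ∷ # 0 ∷ # 0 ∷ # 0 ∷ # 0 ∷ # 0 ∷ # 0 ∷ # 0 ∷
      # 0 ∷ # 0 ∷ []
  }

certificate-6-54 : Certificate 6
certificate-6-54 = record
  { rows   =
      15546421223310229422 ∷ 18156259369887465453 ∷ 16140895429430312443 ∷ 13762789354739068151 ∷
      18445899648241692652 ∷ 9222756310179635167 ∷ 18437719279985686462 ∷ 18158399346737412735 ∷
      18158504899040312951 ∷ 18299791046121356787 ∷ 17219510409291594623 ∷ 18428725231921903551 ∷
      18446427105088237543 ∷ 8052400948787519455 ∷ 17870280005671950335 ∷ 16573246452629666811 ∷
      18437736863649136303 ∷ 8056922136882052863 ∷ 18446742965539563435 ∷ 18423662988179651439 ∷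
      18437719282200276411 ∷ 4611685520074719231 ∷ 6341068099206250455 ∷ 18437173579805089503 ∷
      6250987486672043999 ∷ 13726960600351756287 ∷ 18301484293826478075 ∷ 6917509236228355999 ∷
      18121350203196833524 ∷ 18338475163185569647 ∷ 17000804368217276287 ∷ 18445406515666810557 ∷
      16140605806964735999 ∷ 17284633941839116287 ∷ 13834917094453394428 ∷ 18428658718041139197 ∷
      18443014169446842367 ∷ 17253290017830699003 ∷ 18419721032825827324 ∷ 11383973366454025215 ∷
      17869718988405849595 ∷ 15996783675618343933 ∷ 18445543393590244858 ∷ 18446277876165639807 ∷
      9222791494512803231 ∷ 17870098594325843807 ∷ 18194467622559416183 ∷ 18408278730469277687 ∷
      18117690955753582575 ∷ 18156806155990990287 ∷ 18228877422730674175 ∷ 13395816285405706749 ∷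
      17809203112946565119 ∷ 8061443049515712447 ∷ 17271304261710895102 ∷ 18333661363538231295 ∷
      13725775394987047927 ∷ 15993335059109084671 ∷ 13543731453044457085 ∷ 13254057419446632446 ∷
      17266800824235678719 ∷ 15996783123190775802 ∷ 12896056966004080631 ∷ 9214347245256564703 ∷ []
  ; root   = # 0
  ; parent =
      # 0 ∷ # 0 ∷ # 0 ∷ # 0 ∷ # 2 ∷ # 0 ∷ # 1 ∷ # 0 ∷ # 0 ∷ # 0 ∷ # 0 ∷ # 0 ∷ # 0 ∷ # 0 ∷ # 0 ∷
      # 0 ∷ # 0 ∷ # 0 ∷ # 0 ∷ # 0 ∷ # 0 ∷ # 0 ∷ # 0 ∷ # 0 ∷ # 0 ∷ # 0 ∷ # 0 ∷ # 0 ∷ # 2 ∷ # 0 ∷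
      # 0 ∷ # 0 ∷ # 0 ∷ # 0 ∷ # 2 ∷ # 0 ∷ # 0 ∷ # 0 ∷ # 2 ∷ # 0 ∷ # 0 ∷ # 0 ∷ # 1 ∷ # 0 ∷ # 0 ∷
      # 0 ∷ # 0 ∷ # 0 ∷ # 0 ∷ # 0 ∷ # 0 ∷ # 0 ∷ # 0 ∷ # 0 ∷ # 1 ∷ # 0 ∷ # 0 ∷ # 0 ∷ # 0 ∷ # 1 ∷
      # 0 ∷ # 1 ∷ # 0 ∷ # 0 ∷ []
  }

certificate-7-114 : Certificate 7
certificate-7-114 = record
  { rows   =
      329565383806393129773787461619749451774 ∷ 338932359584135206014861447048569290741 ∷
      340111021124606623781222684711897266939 ∷ 339950039452653684892866972807803666421 ∷
      338951840811305319808114711427395878319 ∷ 170016567048368064644752680030717345759 ∷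
      249546979317732261163626252153785416623 ∷ 339950059921992234199945507719792754559 ∷
      340095439143002192906841418038662119163 ∷ 340261592662899504797141952290856367599 ∷
      326904332299907466826352340284691413947 ∷ 337623870354335209865983702003030685182 ∷
      293593233251692578090238765929521475583 ∷ 340116129122695598080209009105224589311 ∷
      319014668118947667663253015586804514559 ∷ 336917757916592894849509214885181881334 ∷
      168811945322241536067139074358106832767 ∷ 334962209593650541198808667448516935679 ∷
      334134682369830826637700423074228969455 ∷ 334964481064604994432374931257491455743 ∷
      297747071054505729942649682749813686271 ∷ 340260946158619907855301625435077475695 ∷
      329648522669773650388714904741358722927 ∷ 318677219375661478914608286646272983039 ∷
      297746746536184224011320930955864014843 ∷ 255209179032351717056247659561475637245 ∷
      169767338086654714691861225289558130655 ∷ 340282366920936043247052830817149513695 ∷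
      336917676139492459104559463360752123903 ∷ 340188899873018449617650642425627998079 ∷
      340282361845248821830956593936991215614 ∷ 318931621876217260551575603174107508447 ∷
      332306998946151577641308604091479850879 ∷ 255211772655392975686092303629178372031 ∷
      297746908717316163654528254383405137405 ∷ 169762145631328983879806131938078425087 ∷
      334962857363260177606737549385124216831 ∷ 313671845520947471867083753813569437181 ∷
      339285425324776913662098542979140550591 ∷ 337622612835344445082836508902565085175 ∷
      340279750481429024713590391571983105919 ∷ 340282366920628974893286616704313980799 ∷
      318983524637457028418658819128076263423 ∷ 297747070976437910424788043011205103615 ∷
      255211126152972725015247500244168990719 ∷ 255191005904233891231355456583299497907 ∷
      340281068846646458493491659158712089983 ∷ 340198798322072676396211607019727085310 ∷
      329647224518760778536401331645851893755 ∷ 328973462876865120005722559549534093295 ∷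
      339949410884884917640495711284751220093 ∷ 255211773249608879178974460376971735035 ∷
      338204150063695741880822498728741961695 ∷ 340281393365277488183035490683676786634 ∷
      339778307209817911183305030712533385087 ∷ 340271982168755397340712995192474402687 ∷
      319011473802451533263872298335005040631 ∷ 340259001585065229344290304908211519487 ∷
      340282366910679518884049375250251511293 ∷ 319014718987759554937652921212841096703 ∷
      255206400342255358999135058678735962111 ∷ 340074588836452734485007588179184187391 ∷
      170099645060841849387872503798893117439 ∷ 339596982259523111864239301822632689661 ∷
      338953138925153526025614486456674275223 ∷ 328970948172530380094530509429272477693 ∷
      336790547283419049004442369416780836863 ∷ 338951513797084054852641432052241858303 ∷
      340282042392480056519697610416065591163 ∷ 340282001837543836472475479675256175871 ∷
      212509025214121653089570040240707993594 ∷ 169466184235033943576684812312734728191 ∷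
      329627752214592192061896432865836531679 ∷ 340238232370241775429121278647809851391 ∷
      340282042362693105469816657990740082671 ∷ 340280947152111416937277800379589770235 ∷
      170141158107399104279847149285751652350 ∷ 340271961390540964214486820311424565227 ∷
      169932790493641565225602118135855448063 ∷ 297746989733063490332341915657636282047 ∷
      323665029297465305153717657685651351551 ∷ 338620820517339826719399766015898287614 ∷
      340277012324565212441966527967683140607 ∷ 169808693904969190723893717065533489151 ∷
      334965454898009192484529055240892186607 ∷ 297408191285998101929829402881155923935 ∷
      244494549956056910081157208673247817727 ∷ 286947091054593380981950853717052751871 ∷
      313693912782286759865172061079105168319 ∷ 339939674654211826629419505561978273535 ∷
      318920608408510519421200353863043808246 ∷ 340282326343700852524912826424106156021 ∷
      338952971590312271988236900102733512695 ∷ 337623261879871638293674627795976714237 ∷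
      255170236716799600805690342975914114775 ∷ 328319314917379031839197702084381114351 ∷
      148865741754528544208051662709011251199 ∷ 170135950359868457546470324017980882935 ∷
      329585743860836480052650791422066683903 ∷ 340240634911821876483749649638450224127 ∷
      340282355195129000911320721364218806238 ∷ 337611373547864980638652594692288405503 ∷
      292264000418425978410231403036551150847 ∷ 249806095340455182144867087026753552381 ∷
      340271961410976587238664639741368991735 ∷ 255045416170899741506653305488103421951 ∷
      333615376624902002311265995592759761918 ∷ 167482511012593143747579425124283056127 ∷
      319014384011631308012328250754693857279 ∷ 338952487341602058769633282020091494399 ∷
      170139882850603978899350448009551806447 ∷ 297744474827854231036923229460437531647 ∷
      255206572514912502070597137598026612667 ∷ 340251190320219386816705349544342192063 ∷
      340251131693236185102130368476176448765 ∷ 340157750825788325117446341540033036255 ∷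
      336834671664351224800449785013660023774 ∷ 340116167785888694769935147056288747259 ∷
      339950059921322489591063010496181436215 ∷ 296999380308190928945032630663552663551 ∷
      328318584747560229715166962370467524589 ∷ 316273021442591870451157378785687331839 ∷
      334965358596023145877570071466054123455 ∷ 328319314602114161850604385845580397566 ∷
      273820642532363423827437885440579846143 ∷ 275812207906144341526168316259951702015 ∷
      255206532167936890577958097736788082623 ∷ 170139722889283229706953292640468008927 ∷ []
  ; root   = # 0
  ; parent =
      # 0 ∷ # 0 ∷ # 0 ∷ # 0 ∷ # 0 ∷ # 0 ∷ # 0 ∷ # 0 ∷ # 0 ∷ # 0 ∷ # 0 ∷ # 1 ∷ # 0 ∷ # 0 ∷ # 0 ∷
      # 1 ∷ # 0 ∷ # 0 ∷ # 0 ∷ # 0 ∷ # 0 ∷ # 0 ∷ # 0 ∷ # 0 ∷ # 0 ∷ # 0 ∷ # 0 ∷ # 0 ∷ # 0 ∷ # 0 ∷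
      # 1 ∷ # 0 ∷ # 0 ∷ # 0 ∷ # 0 ∷ # 0 ∷ # 0 ∷ # 0 ∷ # 0 ∷ # 0 ∷ # 0 ∷ # 0 ∷ # 0 ∷ # 0 ∷ # 0 ∷
      # 0 ∷ # 0 ∷ # 1 ∷ # 0 ∷ # 0 ∷ # 0 ∷ # 0 ∷ # 0 ∷ # 1 ∷ # 0 ∷ # 0 ∷ # 0 ∷ # 0 ∷ # 0 ∷ # 0 ∷
      # 0 ∷ # 0 ∷ # 0 ∷ # 0 ∷ # 0 ∷ # 0 ∷ # 0 ∷ # 0 ∷ # 0 ∷ # 0 ∷ # 1 ∷ # 0 ∷ # 0 ∷ # 0 ∷ # 0 ∷
      # 0 ∷ # 1 ∷ # 0 ∷ # 0 ∷ # 0 ∷ # 0 ∷ # 1 ∷ # 0 ∷ # 0 ∷ # 0 ∷ # 0 ∷ # 0 ∷ # 0 ∷ # 0 ∷ # 0 ∷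
      # 1 ∷ # 0 ∷ # 0 ∷ # 0 ∷ # 0 ∷ # 0 ∷ # 0 ∷ # 0 ∷ # 0 ∷ # 0 ∷ # 1 ∷ # 0 ∷ # 0 ∷ # 0 ∷ # 0 ∷
      # 0 ∷ # 1 ∷ # 0 ∷ # 0 ∷ # 0 ∷ # 0 ∷ # 0 ∷ # 0 ∷ # 0 ∷ # 0 ∷ # 0 ∷ # 1 ∷ # 0 ∷ # 0 ∷ # 0 ∷
      # 0 ∷ # 0 ∷ # 0 ∷ # 1 ∷ # 0 ∷ # 0 ∷ # 0 ∷ # 0 ∷ []
  }

theorem6 : (n k : ℕ) →
  ((n ≡ 4 × (k ≡ 4 ⊎ k ≡ 6 ⊎ k ≡ 8 ⊎ k ≡ 10))
   ⊎ (n ≡ 5 × (k ≡ 4 ⊎ k ≡ 16 ⊎ k ≡ 18 ⊎ k ≡ 20 ⊎ k ≡ 22 ⊎ k ≡ 24 ⊎ k ≡ 26))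
   ⊎ (n ≡ 6 × k ≡ 54)
   ⊎ (n ≡ 7 × k ≡ 114)) →
  ExistsRegularCXM n k
theorem6 _ _ (inj₁ (refl , inj₁ refl))                                           = certify certificate-4-4 4
theorem6 _ _ (inj₁ (refl , inj₂ (inj₁ refl)))                                    = certify certificate-4-6 6
theorem6 _ _ (inj₁ (refl , inj₂ (inj₂ (inj₁ refl))))                             = certify certificate-4-8 8
theorem6 _ _ (inj₁ (refl , inj₂ (inj₂ (inj₂ refl))))                             = certify certificate-4-10 10
theorem6 _ _ (inj₂ (inj₁ (refl , inj₁ refl)))                                    = certify certificate-5-4 4
theorem6 _ _ (inj₂ (inj₁ (refl , inj₂ (inj₁ refl))))                             = certify certificate-5-16 16
theorem6 _ _ (inj₂ (inj₁ (refl , inj₂ (inj₂ (inj₁ refl)))))                      = certify certificate-5-18 18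
theorem6 _ _ (inj₂ (inj₁ (refl , inj₂ (inj₂ (inj₂ (inj₁ refl))))))               = certify certificate-5-20 20
theorem6 _ _ (inj₂ (inj₁ (refl , inj₂ (inj₂ (inj₂ (inj₂ (inj₁ refl)))))))        = certify certificate-5-22 22
theorem6 _ _ (inj₂ (inj₁ (refl , inj₂ (inj₂ (inj₂ (inj₂ (inj₂ (inj₁ refl)))))))) = certify certificate-5-24 24
theorem6 _ _ (inj₂ (inj₁ (refl , inj₂ (inj₂ (inj₂ (inj₂ (inj₂ (inj₂ refl)))))))) = certify certificate-5-26 26
theorem6 _ _ (inj₂ (inj₂ (inj₁ (refl , refl))))                                  = certify certificate-6-54 54
theorem6 _ _ (inj₂ (inj₂ (inj₂ (refl , refl))))                                  = certify certificate-7-114 114
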